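{- Let $p$ be a prime and $n$ a positive integer. Let $\mathcal{F}$ be a linear, affine-invariant family of functions $\mathbb{F}_p^n\to\mathbb{F}_p$, and suppose the monomial function $x^e$ belongs to $\mathcal{F}$ for some $e\in\{0,\dots,p-1\}^n$. Then $x^{e'}\in\mathcal{F}$ for every $e'\in\{0,\dots,p-1\}^n$ with $|e'|_1\le|e|_1$.
   Context: For $e\in\{0,\dots,p-1\}^n$, $x^e$ denotes the function $x\mapsto\prod_{i=1}^n x_i^{e_i}$ and $|e|_1=\sum_i e_i$. A family $\mathcal{F}$ of functions $\mathbb{F}_p^n\to\mathbb{F}_p$ is linear if it contains the zero function and $\alpha f+\beta g\in\mathcal{F}$ for all $f,g\in\mathcal{F}$ and $\alpha,\beta\in\mathbb{F}_p$. It is affine-invariant if $f\circ T\in\mathcal{F}$ for every $f\in\mathcal{F}$ and every affine transformation $T:\mathbb{F}_p^n\to\mathbb{F}_p^n$. -}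

module Defs where

open import Level using (Level)
open import Data.Nat using (ℕ; zero; suc; NonZero) renaming (_+_ to _+ℕ_; _*_ to _*ℕ_)
open import Data.Nat.DivMod using (_mod_)
open import Data.Fin using (Fin; toℕ) renaming (zero to fzero; suc to fsuc)
open import Relation.Binary.PropositionalEquality using (_≡_)

module Field (p : ℕ) .{{_ : NonZero p}} where

  Fp : Set
  Fp = Fin p

  0ₚ : Fp
  0ₚ = 0 mod p

  1ₚ : Fp
  1ₚ = 1 mod p

  infixl 6 _+ₚ_
  infixl 7 _*ₚ_
  _+ₚ_ : Fp → Fp → Fp
  a +ₚ b = (toℕ a +ℕ toℕ b) mod p

  _*ₚ_ : Fp → Fp → Fp
  a *ₚ b = (toℕ a *ℕ toℕ b) mod p

  _^ₚ_ : Fp → ℕ → Fp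
  a ^ₚ zero = 1ₚ
  a ^ₚ suc k = a *ₚ (a ^ₚ k)

  Pt : ℕ → Set
  Pt n = Fin n → Fp

  Fun : ℕ → Set
  Fun n = Pt n → Fp

  sumₚ : ∀ {n} → (Fin n → Fp) → Fp
  sumₚ {zero} f = 0ₚ
  sumₚ {suc n} f = f fzero +ₚ sumₚ (λ i → f (fsuc i))

  prodₚ : ∀ {n} → (Fin n → Fp) → Fp
  prodₚ {zero} f = 1ₚ
  prodₚ {suc n} f = f fzero *ₚ prodₚ (λ i → f (fsuc i))

  Exp : ℕ → Set
  Exp n = Fin n → Fin p

  mono : ∀ {n} → Exp n → Fun n
  mono e x = prodₚ (λ i → x i ^ₚ toℕ (e i))

  norm1 : ∀ {n} → Exp n → ℕ
  norm1 {zero} e = 0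
  norm1 {suc n} e = toℕ (e fzero) +ℕ norm1 (λ i → e (fsuc i))

  affine : ∀ {n} → (Fin n → Fin n → Fp) → Pt n → Pt n → Pt n
  affine A b x i = sumₚ (λ j → A i j *ₚ x j) +ₚ b i

  Family : ℕ → Set₁
  Family n = Fun n → Set

  -- a family is a set of functions, so membership respects pointwise equality
  Extensional : ∀ {n} → Family n → Set
  Extensional {n} 𝓕 = ∀ (f g : Fun n) → (∀ x → f x ≡ g x) → 𝓕 f → 𝓕 g

  IsLinear : ∀ {n} → Family n → Set
  IsLinear {n} 𝓕 =
    𝓕 (λ _ → 0ₚ) ×' (∀ (f g : Fun n) (α β : Fp) → 𝓕 f → 𝓕 g → 𝓕 (λ x → α *ₚ f x +ₚ β *ₚ g x))
    where
      open import Data.Product using () renaming (_×_ to _×'_)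

  AffineInvariant : ∀ {n} → Family n → Set
  AffineInvariant {n} 𝓕 =
    ∀ (f : Fun n) (A : Fin n → Fin n → Fp) (b : Pt n) → 𝓕 f → 𝓕 (λ x → f (affine A b x))

-- If x^u ∈ 𝓕 with uᵢ = a + 1 < p, the affine substitution xᵢ ↦ c xᵢ + w (w = α xⱼ + β) puts
-- (c xᵢ + w)ᵃ⁺¹ G in 𝓕 for every c ∈ 𝔽ₚ, where G is x^u without its xᵢ-factor. Removing the
-- top term cᵃ⁺¹ x^u leaves a polynomial in c of degree a < p with leading coefficient
-- (a + 1) xᵢᵃ w G, which a-fold finite differencing in c isolates, each step dividing by a unit of 𝔽ₚ.
-- With w = 1 this lowers uᵢ by one, with w = xⱼ it moves one unit of exponent from xᵢ to xⱼ.
-- Every exponent vector e′ with entries below p and |e′|₁ ≤ |e|₁ is reached from e by such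
-- moves: each one brings the current vector strictly closer to e′ in ℓ¹-distance.

module Submission where

open import Defs
open import Level using (_⊔_; 0ℓ)
open import Data.Nat as ℕ using (ℕ; zero; suc; pred; NonZero; _≤_; _<_; z≤n; s≤s; _∸_; _%_; ∣_-_∣; _<?_)
import Data.Nat.Properties as ℕ
open import Data.Nat.DivMod using (_mod_; %-distribˡ-+; %-distribˡ-*; m<n⇒m%n≡m; n%n≡0; m%n<n)
open import Data.Nat.Primality using (Prime)
open import Data.Nat.Coprimality using (prime⇒coprime; coprime-Bézout)
open import Data.Nat.GCD using (module Bézout)
open import Data.Nat.Induction using (<-wellFounded)
open import Data.Fin using (Fin; toℕ; _≟_) renaming (zero to fzero; suc to fsuc)
open import Data.Fin.Properties using (toℕ-injective; toℕ-fromℕ<; toℕ<n; any?)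
open import Data.Vec.Functional using (updateAt)
open import Data.Vec.Functional.Properties using (updateAt-updates; updateAt-minimal; updateAt-updateAt)
open import Data.Product using (∃; ∃₂; _,_; proj₁; proj₂) renaming (_×_ to _∧_)
open import Data.Sum using (_⊎_; inj₁; inj₂)
open import Function using (_∘_)
open import Induction.WellFounded using (Acc; acc)
open import Relation.Nullary using (yes; no)
open import Relation.Binary.PropositionalEquality
  using (_≡_; _≢_; _≗_; refl; sym; trans; cong; cong₂; subst; subst₂; isEquivalence; module ≡-Reasoning)
open import Algebra.Bundles using (CommutativeSemiring; CommutativeRing)
open import Algebra.Structures using (IsCommutativeRing)
open import Algebra.Consequences.Propositional using (comm∧idˡ⇒id; comm∧invˡ⇒inv; comm∧distrʳ⇒distrˡ)
open import Algebra.Properties.CommutativeMonoid.Sum ℕ.+-0-commutativeMonoid using (sum)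

module ResidueRing (p : ℕ) .{{_ : NonZero p}} where
  open Field p
  open ≡-Reasoning

  [_] : ℕ → Fp
  [ m ] = m mod p

  -ₚ_ : Fp → Fp
  -ₚ a = [ p ∸ toℕ a ]

  private
    toℕ-[] : ∀ m → toℕ [ m ] ≡ m % p
    toℕ-[] m = toℕ-fromℕ< (m%n<n m p)

    []-cong-% : ∀ {m n} → m % p ≡ n % p → [ m ] ≡ [ n ]
    []-cong-% {m} {n} eq = toℕ-injective (trans (toℕ-[] m) (trans eq (sym (toℕ-[] n))))

  [toℕ] : ∀ a → [ toℕ a ] ≡ a
  [toℕ] a = toℕ-injective (trans (toℕ-[] (toℕ a)) (m<n⇒m%n≡m (toℕ<n a)))

  [+] : ∀ m n → [ m ℕ.+ n ] ≡ [ m ] +ₚ [ n ]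
  [+] m n = []-cong-% (begin
    (m ℕ.+ n) % p                          ≡⟨ %-distribˡ-+ m n p ⟩
    (m % p ℕ.+ n % p) % p                  ≡⟨ cong₂ (λ a b → (a ℕ.+ b) % p) (toℕ-[] m) (toℕ-[] n) ⟨
    (toℕ [ m ] ℕ.+ toℕ [ n ]) % p          ∎)

  [*] : ∀ m n → [ m ℕ.* n ] ≡ [ m ] *ₚ [ n ]
  [*] m n = []-cong-% (begin
    (m ℕ.* n) % p                          ≡⟨ %-distribˡ-* m n p ⟩
    (m % p ℕ.* (n % p)) % p                ≡⟨ cong₂ (λ a b → (a ℕ.* b) % p) (toℕ-[] m) (toℕ-[] n) ⟨
    (toℕ [ m ] ℕ.* toℕ [ n ]) % p          ∎)

  [p]≡0 : [ p ] ≡ 0ₚ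
  [p]≡0 = []-cong-% (trans (n%n≡0 p) (sym (m<n⇒m%n≡m (ℕ.>-nonZero⁻¹ p))))

  private
    toℕ-0ₚ : toℕ 0ₚ ≡ 0
    toℕ-0ₚ = trans (toℕ-[] 0) (m<n⇒m%n≡m (ℕ.>-nonZero⁻¹ p))

    +ₚ-assoc : ∀ a b c → (a +ₚ b) +ₚ c ≡ a +ₚ (b +ₚ c)
    +ₚ-assoc a b c = begin
      [ toℕ a ℕ.+ toℕ b ] +ₚ c             ≡⟨ cong ([ toℕ a ℕ.+ toℕ b ] +ₚ_) ([toℕ] c) ⟨
      [ toℕ a ℕ.+ toℕ b ] +ₚ [ toℕ c ]     ≡⟨ [+] (toℕ a ℕ.+ toℕ b) (toℕ c) ⟨
      [ toℕ a ℕ.+ toℕ b ℕ.+ toℕ c ]        ≡⟨ cong [_] (ℕ.+-assoc (toℕ a) (toℕ b) (toℕ c)) ⟩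
      [ toℕ a ℕ.+ (toℕ b ℕ.+ toℕ c) ]      ≡⟨ [+] (toℕ a) (toℕ b ℕ.+ toℕ c) ⟩
      [ toℕ a ] +ₚ (b +ₚ c)                ≡⟨ cong (_+ₚ (b +ₚ c)) ([toℕ] a) ⟩
      a +ₚ (b +ₚ c)                        ∎

    *ₚ-assoc : ∀ a b c → (a *ₚ b) *ₚ c ≡ a *ₚ (b *ₚ c)
    *ₚ-assoc a b c = begin
      [ toℕ a ℕ.* toℕ b ] *ₚ c             ≡⟨ cong ([ toℕ a ℕ.* toℕ b ] *ₚ_) ([toℕ] c) ⟨
      [ toℕ a ℕ.* toℕ b ] *ₚ [ toℕ c ]     ≡⟨ [*] (toℕ a ℕ.* toℕ b) (toℕ c) ⟨
      [ toℕ a ℕ.* toℕ b ℕ.* toℕ c ]        ≡⟨ cong [_] (ℕ.*-assoc (toℕ a) (toℕ b) (toℕ c)) ⟩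
      [ toℕ a ℕ.* (toℕ b ℕ.* toℕ c) ]      ≡⟨ [*] (toℕ a) (toℕ b ℕ.* toℕ c) ⟩
      [ toℕ a ] *ₚ (b *ₚ c)                ≡⟨ cong (_*ₚ (b *ₚ c)) ([toℕ] a) ⟩
      a *ₚ (b *ₚ c)                        ∎

    *ₚ-distribʳ-+ₚ : ∀ a b c → (b +ₚ c) *ₚ a ≡ (b *ₚ a) +ₚ (c *ₚ a)
    *ₚ-distribʳ-+ₚ a b c = begin
      [ toℕ b ℕ.+ toℕ c ] *ₚ a                    ≡⟨ cong ([ toℕ b ℕ.+ toℕ c ] *ₚ_) ([toℕ] a) ⟨
      [ toℕ b ℕ.+ toℕ c ] *ₚ [ toℕ a ]            ≡⟨ [*] (toℕ b ℕ.+ toℕ c) (toℕ a) ⟨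
      [ (toℕ b ℕ.+ toℕ c) ℕ.* toℕ a ]             ≡⟨ cong [_] (ℕ.*-distribʳ-+ (toℕ a) (toℕ b) (toℕ c)) ⟩
      [ toℕ b ℕ.* toℕ a ℕ.+ toℕ c ℕ.* toℕ a ]     ≡⟨ [+] (toℕ b ℕ.* toℕ a) (toℕ c ℕ.* toℕ a) ⟩
      (b *ₚ a) +ₚ (c *ₚ a)                        ∎

    +ₚ-identityˡ : ∀ a → 0ₚ +ₚ a ≡ a
    +ₚ-identityˡ a = trans (cong (λ z → [ z ℕ.+ toℕ a ]) toℕ-0ₚ) ([toℕ] a)

    *ₚ-identityˡ : ∀ a → 1ₚ *ₚ a ≡ a
    *ₚ-identityˡ a = begin
      1ₚ *ₚ a               ≡⟨ cong (1ₚ *ₚ_) ([toℕ] a) ⟨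
      [ 1 ] *ₚ [ toℕ a ]    ≡⟨ [*] 1 (toℕ a) ⟨
      [ 1 ℕ.* toℕ a ]       ≡⟨ cong [_] (ℕ.*-identityˡ (toℕ a)) ⟩
      [ toℕ a ]             ≡⟨ [toℕ] a ⟩
      a                     ∎

    -ₚ-inverseˡ : ∀ a → (-ₚ a) +ₚ a ≡ 0ₚ
    -ₚ-inverseˡ a = begin
      [ p ∸ toℕ a ] +ₚ a               ≡⟨ cong ([ p ∸ toℕ a ] +ₚ_) ([toℕ] a) ⟨
      [ p ∸ toℕ a ] +ₚ [ toℕ a ]       ≡⟨ [+] (p ∸ toℕ a) (toℕ a) ⟨
      [ p ∸ toℕ a ℕ.+ toℕ a ]          ≡⟨ cong [_] (ℕ.m∸n+n≡m (ℕ.<⇒≤ (toℕ<n a))) ⟩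
      [ p ]                            ≡⟨ [p]≡0 ⟩
      0ₚ                               ∎

    +ₚ-comm : ∀ a b → a +ₚ b ≡ b +ₚ a
    +ₚ-comm a b = cong [_] (ℕ.+-comm (toℕ a) (toℕ b))

    *ₚ-comm : ∀ a b → a *ₚ b ≡ b *ₚ a
    *ₚ-comm a b = cong [_] (ℕ.*-comm (toℕ a) (toℕ b))

  Fp-isCommutativeRing : IsCommutativeRing _≡_ _+ₚ_ _*ₚ_ -ₚ_ 0ₚ 1ₚ
  Fp-isCommutativeRing = record
    { isRing = record
      { +-isAbelianGroup = record
        { isGroup = record
          { isMonoid = record
            { isSemigroup = record
              { isMagma = record { isEquivalence = isEquivalence ; ∙-cong = cong₂ _+ₚ_ }
              ; assoc = +ₚ-assoc
              }
            ; identity = comm∧idˡ⇒id +ₚ-comm +ₚ-identityˡ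
            }
          ; inverse = comm∧invˡ⇒inv +ₚ-comm -ₚ-inverseˡ
          ; ⁻¹-cong = cong -ₚ_
          }
        ; comm = +ₚ-comm
        }
      ; *-cong = cong₂ _*ₚ_
      ; *-assoc = *ₚ-assoc
      ; *-identity = comm∧idˡ⇒id *ₚ-comm *ₚ-identityˡ
      ; distrib = comm∧distrʳ⇒distrˡ *ₚ-comm *ₚ-distribʳ-+ₚ , *ₚ-distribʳ-+ₚ
      }
    ; *-comm = *ₚ-comm
    }

  Fp-commutativeRing : CommutativeRing 0ℓ 0ℓ
  Fp-commutativeRing = record { isCommutativeRing = Fp-isCommutativeRing }

  open CommutativeRing Fp-commutativeRing public hiding (refl; sym; trans)
  open import Algebra.Properties.Semiring.Mult semiring public using (_×_)
  open import Algebra.Properties.Semiring.Exp semiring public using (_^_)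
  open import Algebra.Properties.Ring ring using (-‿distribˡ-*)
  open import Algebra.Properties.AbelianGroup +-abelianGroup using (inverseʳ-unique; ⁻¹-involutive)

  ×-[] : ∀ k y → k × y ≡ [ k ] * y
  ×-[] zero    y = sym (zeroˡ y)
  ×-[] (suc k) y = begin
    y + k × y               ≡⟨ cong₂ _+_ (*-identityˡ y) (sym (×-[] k y)) ⟨
    [ 1 ] * y + [ k ] * y   ≡⟨ distribʳ y [ 1 ] [ k ] ⟨
    ([ 1 ] + [ k ]) * y     ≡⟨ cong (_* y) ([+] 1 k) ⟨
    [ suc k ] * y           ∎

  []-invertible : Prime p → ∀ {k} → 0 ℕ.< k → k ℕ.< p → ∃ λ b → b * [ k ] ≡ 1#
  []-invertible p-prime {k} 0<k k<p with coprime-Bézout (prime⇒coprime p-prime {{ℕ.>-nonZero 0<k}} k<p)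
  ... | Bézout.-+ x y 1+xp≡yk = [ y ] , (begin
    [ y ] * [ k ]          ≡⟨ [*] y k ⟨
    [ y ℕ.* k ]            ≡⟨ cong [_] 1+xp≡yk ⟨
    [ 1 ℕ.+ x ℕ.* p ]      ≡⟨ [+] 1 (x ℕ.* p) ⟩
    1# + [ x ℕ.* p ]       ≡⟨ cong (1# +_) (trans ([*] x p) (cong ([ x ] *_) [p]≡0)) ⟩
    1# + [ x ] * 0#        ≡⟨ cong (1# +_) (zeroʳ [ x ]) ⟩
    1# + 0#                ≡⟨ +-identityʳ 1# ⟩
    1#                     ∎)
  ... | Bézout.+- x y 1+yk≡xp = - [ y ] , (begin
    - [ y ] * [ k ]        ≡⟨ -‿distribˡ-* [ y ] [ k ] ⟨
    - ([ y ] * [ k ])      ≡⟨ cong -_ (inverseʳ-unique 1# _ 1+yk≡0) ⟩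
    - (- 1#)               ≡⟨ ⁻¹-involutive 1# ⟩
    1#                     ∎)
    where
      1+yk≡0 : 1# + [ y ] * [ k ] ≡ 0#
      1+yk≡0 = begin
        1# + [ y ] * [ k ]     ≡⟨ cong (1# +_) ([*] y k) ⟨
        [ 1 ] + [ y ℕ.* k ]    ≡⟨ [+] 1 (y ℕ.* k) ⟨
        [ 1 ℕ.+ y ℕ.* k ]      ≡⟨ cong [_] 1+yk≡xp ⟩
        [ x ℕ.* p ]            ≡⟨ [*] x p ⟩
        [ x ] * [ p ]          ≡⟨ cong ([ x ] *_) [p]≡0 ⟩
        [ x ] * 0#             ≡⟨ zeroʳ [ x ] ⟩
        0#                     ∎

module Polynomials {c ℓ} (R : CommutativeSemiring c ℓ) where

  open CommutativeSemiring R renaming (refl to ≈-refl; sym to ≈-sym; trans to ≈-trans)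
  open import Algebra.Properties.Semiring.Mult semiring using (_×_; ×-comm-*; ×-homo-1)
  open import Algebra.Properties.Monoid.Mult +-monoid using (×-congʳ)
  open import Algebra.Properties.Semiring.Exp semiring using (_^_)
  open import Algebra.Solver.Ring.NaturalCoefficients.Default R using (solve; _:+_; _:*_; _:=_; con)
  open import Relation.Binary.Reasoning.Setoid setoid

  -- Polynomial d a P: P agrees pointwise with a polynomial function of formal degree d whose
  -- coefficient of Xᵈ is a, given in Horner form P x = b + x Q(x).
  Polynomial : ℕ → Carrier → (Carrier → Carrier) → Set (c ⊔ ℓ)
  Polynomial zero    a P = ∀ x → P x ≈ a
  Polynomial (suc d) a P = ∃₂ λ b Q → Polynomial d a Q ∧ (∀ x → P x ≈ b + x * Q x)

  Polynomial-cong : ∀ {d a a′ P P′} → a ≈ a′ → (∀ x → P x ≈ P′ x) →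
                    Polynomial d a P → Polynomial d a′ P′
  Polynomial-cong {zero}  a≈a′ P≈P′ P≈a = λ x → ≈-trans (≈-sym (P≈P′ x)) (≈-trans (P≈a x) a≈a′)
  Polynomial-cong {suc d} a≈a′ P≈P′ (b , Q , Q-poly , P≈) =
    b , Q , Polynomial-cong a≈a′ (λ _ → ≈-refl) Q-poly , λ x → ≈-trans (≈-sym (P≈P′ x)) (P≈ x)

  Polynomial-raise : ∀ {d a P} → Polynomial d a P → Polynomial (suc d) 0# P
  Polynomial-raise {zero}  {a} P≈a = a , (λ _ → 0#) , (λ _ → ≈-refl) , λ x →
    ≈-trans (P≈a x) (solve 2 (λ a x → a := a :+ x :* con 0) ≈-refl a x)
  Polynomial-raise {suc d} (b , Q , Q-poly , P≈) = b , Q , Polynomial-raise Q-poly , P≈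

  Polynomial-+ : ∀ {d a a′ P P′} → Polynomial d a P → Polynomial d a′ P′ →
                 Polynomial d (a + a′) (λ x → P x + P′ x)
  Polynomial-+ {zero}  P≈a P′≈a′ = λ x → +-cong (P≈a x) (P′≈a′ x)
  Polynomial-+ {suc d} (b , Q , Q-poly , P≈) (b′ , Q′ , Q′-poly , P′≈) =
    b + b′ , (λ x → Q x + Q′ x) , Polynomial-+ Q-poly Q′-poly , λ x →
      ≈-trans (+-cong (P≈ x) (P′≈ x))
              (solve 5 (λ b b′ x q q′ → (b :+ x :* q) :+ (b′ :+ x :* q′) := (b :+ b′) :+ x :* (q :+ q′))
                     ≈-refl b b′ x (Q x) (Q′ x))

  Polynomial-scale : ∀ {d a P} k → Polynomial d a P → Polynomial d (k * a) (λ x → k * P x)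
  Polynomial-scale {zero}  k P≈a = λ x → *-congˡ (P≈a x)
  Polynomial-scale {suc d} k (b , Q , Q-poly , P≈) =
    k * b , (λ x → k * Q x) , Polynomial-scale k Q-poly , λ x →
      ≈-trans (*-congˡ (P≈ x))
              (solve 4 (λ k b x q → k :* (b :+ x :* q) := k :* b :+ x :* (k :* q)) ≈-refl k b x (Q x))

  Polynomial-X* : ∀ {d a P} → Polynomial d a P → Polynomial (suc d) a (λ x → x * P x)
  Polynomial-X* {P = P} P-poly = 0# , P , P-poly , λ x → ≈-sym (+-identityˡ (x * P x))

  Polynomial-shift : ∀ {d a P} → Polynomial d a P → Polynomial d a (λ x → P (x + 1#))
  Polynomial-shift {zero}          P≈a                    = λ x → P≈a (x + 1#)
  Polynomial-shift {suc d} {a} {P} (b , Q , Q-poly , P≈) =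
    Polynomial-cong (+-identityʳ a) expand
      (Polynomial-+ (b , Q₁ , Polynomial-shift Q-poly , λ _ → ≈-refl) (Polynomial-raise (Polynomial-shift Q-poly)))
    where
      Q₁ = λ x → Q (x + 1#)
      expand : ∀ x → (b + x * Q₁ x) + Q₁ x ≈ P (x + 1#)
      expand x = ≈-trans (solve 3 (λ b x q → (b :+ x :* q) :+ q := b :+ (x :+ con 1) :* q) ≈-refl b x (Q₁ x))
                         (≈-sym (P≈ (x + 1#)))

  horner-difference : ∀ {b} {Q P : Carrier → Carrier} (E : Carrier → Carrier) →
                      (∀ x → P x ≈ b + x * Q x) → (∀ x → Q (x + 1#) ≈ Q x + E x) →
                      ∀ x → P (x + 1#) ≈ P x + (x * E x + Q (x + 1#))
  horner-difference {b} {Q} {P} E P≈ Q-step x = begin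
    P (x + 1#)
      ≈⟨ P≈ (x + 1#) ⟩
    b + (x + 1#) * q₁
      ≈⟨ solve 3 (λ b x q → b :+ (x :+ con 1) :* q := (b :+ x :* q) :+ q) ≈-refl b x q₁ ⟩
    (b + x * q₁) + q₁
      ≈⟨ +-congʳ (+-congˡ (*-congˡ (Q-step x))) ⟩
    (b + x * (Q x + E x)) + q₁
      ≈⟨ solve 5 (λ b x q e q₁ → (b :+ x :* (q :+ e)) :+ q₁ := (b :+ x :* q) :+ (x :* e :+ q₁)) ≈-refl b x (Q x) (E x) q₁ ⟩
    (b + x * Q x) + (x * E x + q₁)
      ≈⟨ +-congʳ (P≈ x) ⟨
    P x + (x * E x + q₁) ∎
    where q₁ = Q (x + 1#)

  Polynomial-difference : ∀ {d a P} → Polynomial (suc d) a P →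
                          ∃ λ D → Polynomial d (suc d × a) D ∧ (∀ x → P (x + 1#) ≈ P x + D x)
  Polynomial-difference {zero} {a} (b , Q , Q≈a , P≈) =
    _ , (λ x → ≈-trans (D≈a x) (≈-sym (×-homo-1 a))) , horner-difference {Q = Q} (λ _ → 0#) P≈ Q-step
    where
      D≈a : ∀ x → x * 0# + Q (x + 1#) ≈ a
      D≈a x = ≈-trans (+-cong (zeroʳ x) (Q≈a (x + 1#))) (+-identityˡ a)
      Q-step : ∀ x → Q (x + 1#) ≈ Q x + 0#
      Q-step x = ≈-trans (Q≈a (x + 1#)) (≈-trans (≈-sym (Q≈a x)) (≈-sym (+-identityʳ (Q x))))
  Polynomial-difference {suc d} {a} (b , Q , Q-poly , P≈) with Polynomial-difference Q-poly
  ... | E , E-poly , Q-step =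
    _ , Polynomial-cong (+-comm (suc d × a) a) (λ _ → ≈-refl)
          (Polynomial-+ (Polynomial-X* E-poly) (Polynomial-shift Q-poly)) ,
    horner-difference {Q = Q} E P≈ Q-step

  module _ (t w : Carrier) where

    Polynomial-power : ∀ d → Polynomial d (t ^ d) (λ x → (x * t + w) ^ d)
    Polynomial-power zero    = λ _ → ≈-refl
    Polynomial-power (suc d) =
      Polynomial-cong (+-identityˡ (t ^ suc d)) expand
        (Polynomial-+ (Polynomial-raise (Polynomial-scale w (Polynomial-power d)))
                      (Polynomial-X* (Polynomial-scale t (Polynomial-power d))))
      where
        expand : ∀ x → w * (x * t + w) ^ d + x * (t * (x * t + w) ^ d) ≈ (x * t + w) ^ suc d
        expand x = solve 4 (λ w x t e → w :* e :+ x :* (t :* e) := (x :* t :+ w) :* e) ≈-refl w x t ((x * t + w) ^ d)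

    Polynomial-binomial : ∀ d → ∃ λ Q → Polynomial d (suc d × (t ^ d * w)) Q ∧
                                         (∀ x → (x * t + w) ^ suc d ≈ x ^ suc d * t ^ suc d + Q x)
    Polynomial-binomial zero =
      (λ _ → w) , (λ _ → ≈-sym (≈-trans (×-homo-1 (1# * w)) (*-identityˡ w))) , λ x →
        solve 3 (λ x t w → (x :* t :+ w) :* con 1 := x :* con 1 :* (t :* con 1) :+ w) ≈-refl x t w
    Polynomial-binomial (suc d) with Polynomial-binomial d
    ... | Q , Q-poly , expand =
      _ , Polynomial-cong leading (λ _ → ≈-refl)
            (Polynomial-+ (Polynomial-X* (Polynomial-scale t Q-poly)) (Polynomial-scale w (Polynomial-power (suc d)))) ,
      expand′
      where
        leading : t * (suc d × (t ^ d * w)) + w * t ^ suc d ≈ suc (suc d) × (t ^ suc d * w)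
        leading = begin
          t * (suc d × (t ^ d * w)) + w * t ^ suc d    ≈⟨ +-cong (×-comm-* (suc d) t (t ^ d * w)) (*-comm w (t ^ suc d)) ⟩
          suc d × (t * (t ^ d * w)) + t ^ suc d * w    ≈⟨ +-congʳ (×-congʳ (suc d) (≈-sym (*-assoc t (t ^ d) w))) ⟩
          suc d × (t ^ suc d * w) + t ^ suc d * w      ≈⟨ +-comm _ _ ⟩
          suc (suc d) × (t ^ suc d * w)                ∎
        expand′ : ∀ x → (x * t + w) ^ suc (suc d) ≈
                        x ^ suc (suc d) * t ^ suc (suc d) + (x * (t * Q x) + w * (x * t + w) ^ suc d)
        expand′ x = begin
          (x * t + w) * E                             ≈⟨ distribʳ E (x * t) w ⟩
          x * t * E + w * E                           ≈⟨ +-congʳ (*-congˡ (expand x)) ⟩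
          x * t * (X * T + Q x) + w * E               ≈⟨ solve 7 (λ x t w X T q e → x :* t :* (X :* T :+ q) :+ w :* e
                                                                               := x :* X :* (t :* T) :+ (x :* (t :* q) :+ w :* e))
                                                               ≈-refl x t w X T (Q x) E ⟩
          x * X * (t * T) + (x * (t * Q x) + w * E)   ∎
          where
            E = (x * t + w) ^ suc d
            X = x ^ suc d
            T = t ^ suc d

module NaturalVectors where
  open import Data.Nat using (_+_; >-nonZero)
  open import Data.Nat.Properties hiding (_≟_)
  open import Algebra.Properties.CommutativeSemigroup +-commutativeSemigroup using (xy∙z≈zy∙x)

  ∣pred-∣< : ∀ {u v} → v < u → ∣ pred u - v ∣ < ∣ u - v ∣
  ∣pred-∣< {suc u}       {zero}  _       = subst (_< suc u) (sym (∣-∣-identityʳ u)) (n<1+n u)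
  ∣pred-∣< {suc (suc u)} {suc v} (s≤s h) = ∣pred-∣< {suc u} {v} h

  ∣suc-∣< : ∀ {u v} → u < v → ∣ suc u - v ∣ < ∣ u - v ∣
  ∣suc-∣< {zero}  {suc v} _       = n<1+n v
  ∣suc-∣< {suc u} {suc v} (s≤s h) = ∣suc-∣< h

  sum-mono-≤ : ∀ {m} {u w : Fin m → ℕ} → (∀ k → u k ≤ w k) → sum u ≤ sum w
  sum-mono-≤ {zero}  _   = z≤n
  sum-mono-≤ {suc m} u≤w = +-mono-≤ (u≤w fzero) (sum-mono-≤ (u≤w ∘ fsuc))

  sum-mono-< : ∀ {m} {u w : Fin m → ℕ} → (∀ k → u k ≤ w k) → ∀ i → u i < w i → sum u < sum w
  sum-mono-< u≤w fzero    ui<wi = +-mono-<-≤ ui<wi (sum-mono-≤ (u≤w ∘ fsuc))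
  sum-mono-< u≤w (fsuc i) ui<wi = +-mono-≤-< (u≤w fzero) (sum-mono-< (u≤w ∘ fsuc) i ui<wi)

  sum-updateAt : ∀ {m} (u : Fin m → ℕ) i f → sum (updateAt u i f) + u i ≡ sum u + f (u i)
  sum-updateAt u fzero    f = xy∙z≈zy∙x (f (u fzero)) (sum (u ∘ fsuc)) (u fzero)
  sum-updateAt u (fsuc i) f = begin
    u fzero + sum (updateAt (u ∘ fsuc) i f) + u (fsuc i)     ≡⟨ +-assoc (u fzero) _ _ ⟩
    u fzero + (sum (updateAt (u ∘ fsuc) i f) + u (fsuc i))   ≡⟨ cong (u fzero +_) (sum-updateAt (u ∘ fsuc) i f) ⟩
    u fzero + (sum (u ∘ fsuc) + f (u (fsuc i)))              ≡⟨ +-assoc (u fzero) _ _ ⟨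
    u fzero + sum (u ∘ fsuc) + f (u (fsuc i))                ∎
    where open ≡-Reasoning

  sum-transfer : ∀ {m} (u : Fin m → ℕ) {i j} → i ≢ j → 0 < u i →
                 sum (updateAt (updateAt u i pred) j suc) ≡ sum u
  sum-transfer u {i} {j} i≢j 0<ui = +-cancelʳ-≡ (pred (u i)) _ _ (begin
    sum (updateAt w j suc) + pred (u i)   ≡⟨ cong (_+ pred (u i)) (+-cancelʳ-≡ (u j) _ _ moved-to-j) ⟩
    suc (sum w) + pred (u i)              ≡⟨ +-suc (sum w) (pred (u i)) ⟨
    sum w + suc (pred (u i))              ≡⟨ cong (sum w +_) (suc-pred (u i) {{>-nonZero 0<ui}}) ⟩
    sum w + u i                           ≡⟨ sum-updateAt u i pred ⟩
    sum u + pred (u i)                    ∎)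
    where
      open ≡-Reasoning
      w = updateAt u i pred
      wj≡uj : w j ≡ u j
      wj≡uj = updateAt-minimal j i u (i≢j ∘ sym)
      moved-to-j : sum (updateAt w j suc) + u j ≡ suc (sum w) + u j
      moved-to-j = begin
        sum (updateAt w j suc) + u j   ≡⟨ cong (sum (updateAt w j suc) +_) wj≡uj ⟨
        sum (updateAt w j suc) + w j   ≡⟨ sum-updateAt w j suc ⟩
        sum w + suc (w j)              ≡⟨ +-suc (sum w) (w j) ⟩
        suc (sum w) + w j              ≡⟨ cong (suc (sum w) +_) wj≡uj ⟩
        suc (sum w) + u j              ∎

module Reachability (B : ℕ) {m} (R : (Fin m → ℕ) → Set)
  (R-resp   : ∀ {u w} → u ≗ w → R u → R w)
  (decrease : ∀ {u} i → 0 < u i → u i < B → R u → R (updateAt u i pred))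
  (transfer : ∀ {u} i j → 0 < u i → u i < B → R u → R (updateAt (updateAt u i pred) j suc))
  where

  open NaturalVectors
  open import Data.Nat.Properties hiding (_≟_)

  Bounded : (Fin m → ℕ) → Set
  Bounded u = ∀ k → u k < B

  module _ {v : Fin m → ℕ} (v-bounded : Bounded v) where

    distance : (Fin m → ℕ) → ℕ
    distance u = sum (λ k → ∣ u k - v k ∣)

    -- Moving one unit from a coordinate above v to one below it, or else lowering a coordinate
    -- above v, strictly decreases the ℓ¹-distance to v.
    approach : ∀ {u} → R u → Bounded u → sum v ≤ sum u →
           u ≗ v ⊎ ∃ λ u′ → R u′ ∧ Bounded u′ ∧ sum v ≤ sum u′ ∧ distance u′ < distance u
    approach {u} Ru u-bounded Σv≤Σu with any? (λ i → v i <? u i)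
    ... | no ∄v<u = inj₁ u≗v
      where
        u≤v : ∀ k → u k ≤ v k
        u≤v k = ≮⇒≥ (λ vk<uk → ∄v<u (k , vk<uk))
        u≗v : u ≗ v
        u≗v k = ≤-antisym (u≤v k) (≮⇒≥ λ uk<vk → <⇒≱ (sum-mono-< u≤v k uk<vk) Σv≤Σu)
    ... | yes (i , vi<ui) with any? (λ j → u j <? v j)
    ...   | yes (j , uj<vj) =
      inj₂ (u′ , transfer i j 0<ui (u-bounded i) Ru , u′-bounded , Σv≤Σu′ ,
            sum-mono-< closer i closer-at-i)
      where
        0<ui = ≤-<-trans z≤n vi<ui
        i≢j : i ≢ j
        i≢j refl = <-asym vi<ui uj<vj
        u′ = updateAt (updateAt u i pred) j suc
        at-i : u′ i ≡ pred (u i)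
        at-i = trans (updateAt-minimal i j _ i≢j) (updateAt-updates i u)
        at-j : u′ j ≡ suc (u j)
        at-j = trans (updateAt-updates j _) (cong suc (updateAt-minimal j i u (i≢j ∘ sym)))
        elsewhere : ∀ {k} → k ≢ i → k ≢ j → u′ k ≡ u k
        elsewhere k≢i k≢j = trans (updateAt-minimal _ j _ k≢j) (updateAt-minimal _ i u k≢i)
        u′-bounded : Bounded u′
        u′-bounded k with k ≟ i | k ≟ j
        ... | yes refl | _        = subst (_< B) (sym at-i) (≤-<-trans pred[n]≤n (u-bounded i))
        ... | no _     | yes refl = subst (_< B) (sym at-j) (<-≤-trans (s≤s uj<vj) (v-bounded j))
        ... | no k≢i   | no k≢j   = subst (_< B) (sym (elsewhere k≢i k≢j)) (u-bounded k)
        Σv≤Σu′ : sum v ≤ sum u′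
        Σv≤Σu′ = subst (sum v ≤_) (sym (sum-transfer u i≢j 0<ui)) Σv≤Σu
        closer-at-i : ∣ u′ i - v i ∣ < ∣ u i - v i ∣
        closer-at-i = subst (λ x → ∣ x - v i ∣ < ∣ u i - v i ∣) (sym at-i) (∣pred-∣< vi<ui)
        closer : ∀ k → ∣ u′ k - v k ∣ ≤ ∣ u k - v k ∣
        closer k with k ≟ i | k ≟ j
        ... | yes refl | _        = <⇒≤ closer-at-i
        ... | no _     | yes refl =
          <⇒≤ (subst (λ x → ∣ x - v j ∣ < ∣ u j - v j ∣) (sym at-j) (∣suc-∣< uj<vj))
        ... | no k≢i   | no k≢j   = ≤-reflexive (cong (λ x → ∣ x - v k ∣) (elsewhere k≢i k≢j))
    ...   | no ∄u<v =
      inj₂ (u′ , decrease i 0<ui (u-bounded i) Ru , u′-bounded , sum-mono-≤ v≤u′ ,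
            sum-mono-< closer i closer-at-i)
      where
        0<ui = ≤-<-trans z≤n vi<ui
        u′ = updateAt u i pred
        at-i : u′ i ≡ pred (u i)
        at-i = updateAt-updates i u
        elsewhere : ∀ {k} → k ≢ i → u′ k ≡ u k
        elsewhere k≢i = updateAt-minimal _ i u k≢i
        u′≤u : ∀ k → u′ k ≤ u k
        u′≤u k with k ≟ i
        ... | yes refl = subst (_≤ u i) (sym at-i) pred[n]≤n
        ... | no k≢i   = ≤-reflexive (elsewhere k≢i)
        u′-bounded : Bounded u′
        u′-bounded k = ≤-<-trans (u′≤u k) (u-bounded k)
        v≤u′ : ∀ k → v k ≤ u′ k
        v≤u′ k with k ≟ i
        ... | yes refl = subst (v i ≤_) (sym at-i) (<⇒≤pred vi<ui)
        ... | no k≢i   = subst (v k ≤_) (sym (elsewhere k≢i)) (≮⇒≥ λ uk<vk → ∄u<v (k , uk<vk))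
        closer-at-i : ∣ u′ i - v i ∣ < ∣ u i - v i ∣
        closer-at-i = subst (λ x → ∣ x - v i ∣ < ∣ u i - v i ∣) (sym at-i) (∣pred-∣< vi<ui)
        closer : ∀ k → ∣ u′ k - v k ∣ ≤ ∣ u k - v k ∣
        closer k with k ≟ i
        ... | yes refl = <⇒≤ closer-at-i
        ... | no k≢i   = ≤-reflexive (cong (λ x → ∣ x - v k ∣) (elsewhere k≢i))

    reach : ∀ {u} → Acc _<_ (distance u) → R u → Bounded u → sum v ≤ sum u → R v
    reach (acc rec) Ru u-bounded Σv≤Σu with approach Ru u-bounded Σv≤Σu
    ... | inj₁ u≗v = R-resp u≗v Ru
    ... | inj₂ (u′ , Ru′ , u′-bounded , Σv≤Σu′ , closer) = reach (rec closer) Ru′ u′-bounded Σv≤Σu′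

  reachable : ∀ {u v} → R u → Bounded u → Bounded v → sum v ≤ sum u → R v
  reachable Ru u-bounded v-bounded = reach v-bounded (<-wellFounded _) Ru u-bounded

module Monomials (p : ℕ) .{{_ : NonZero p}} where
  open Field p using (Fp; Pt; Fun; Exp; mono; norm1; prodₚ; _^ₚ_)
  open ResidueRing p
  open import Algebra.Properties.CommutativeSemigroup *-commutativeSemigroup using (x∙yz≈y∙xz)

  monomial : ∀ {n} → (Fin n → ℕ) → Fun n
  monomial u x = prodₚ (λ k → x k ^ u k)

  prodₚ-cong : ∀ {m} {f g : Fin m → Fp} → (∀ k → f k ≡ g k) → prodₚ f ≡ prodₚ g
  prodₚ-cong {zero}  f≡g = refl
  prodₚ-cong {suc m} f≡g = cong₂ _*_ (f≡g fzero) (prodₚ-cong (f≡g ∘ fsuc))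

  ^ₚ≡^ : ∀ y k → y ^ₚ k ≡ y ^ k
  ^ₚ≡^ y zero    = refl
  ^ₚ≡^ y (suc k) = cong (y *_) (^ₚ≡^ y k)

  mono≡monomial : ∀ {n} (e : Exp n) x → mono e x ≡ monomial (toℕ ∘ e) x
  mono≡monomial e x = prodₚ-cong (λ k → ^ₚ≡^ (x k) (toℕ (e k)))

  monomial-cong : ∀ {n} {u v : Fin n → ℕ} → u ≗ v → ∀ {x y : Pt n} → x ≗ y →
                  monomial u x ≡ monomial v y
  monomial-cong u≗v x≗y = prodₚ-cong (λ k → cong₂ _^_ (x≗y k) (u≗v k))

  monomial-split : ∀ {n} (u : Fin n → ℕ) i x →
                   monomial u x ≡ x i ^ u i * monomial (updateAt u i (λ _ → 0)) x
  monomial-split u fzero    x = cong (x fzero ^ u fzero *_) (sym (*-identityˡ _))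
  monomial-split u (fsuc i) x = trans (cong (x fzero ^ u fzero *_) (monomial-split (u ∘ fsuc) i (x ∘ fsuc)))
    (x∙yz≈y∙xz (x fzero ^ u fzero) (x (fsuc i) ^ u (fsuc i))
               (monomial (updateAt (u ∘ fsuc) i (λ _ → 0)) (x ∘ fsuc)))

  monomial-ignores : ∀ {n} (u : Fin n → ℕ) i f x →
                     monomial (updateAt u i (λ _ → 0)) (updateAt x i f) ≡ monomial (updateAt u i (λ _ → 0)) x
  monomial-ignores u fzero    f x = refl
  monomial-ignores u (fsuc i) f x = cong (x fzero ^ u fzero *_) (monomial-ignores (u ∘ fsuc) i f (x ∘ fsuc))

  monomial-updateAt : ∀ {n} (u : Fin n → ℕ) i f x →
                      monomial (updateAt u i f) x ≡ x i ^ f (u i) * monomial (updateAt u i (λ _ → 0)) x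
  monomial-updateAt u i f x = trans (monomial-split (updateAt u i f) i x)
    (cong₂ (λ a b → x i ^ a * b) (updateAt-updates i u) (monomial-cong (updateAt-updateAt i u) (λ _ → refl)))

  monomial-updateAt-suc : ∀ {n} (u : Fin n → ℕ) i x → monomial (updateAt u i suc) x ≡ x i * monomial u x
  monomial-updateAt-suc u fzero    x = *-assoc (x fzero) (x fzero ^ u fzero) (monomial (u ∘ fsuc) (x ∘ fsuc))
  monomial-updateAt-suc u (fsuc i) x =
    trans (cong (x fzero ^ u fzero *_) (monomial-updateAt-suc (u ∘ fsuc) i (x ∘ fsuc)))
    (x∙yz≈y∙xz (x fzero ^ u fzero) (x (fsuc i)) (monomial (u ∘ fsuc) (x ∘ fsuc)))

  norm1≡sum : ∀ {n} (e : Exp n) → norm1 e ≡ sum (toℕ ∘ e)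
  norm1≡sum {zero}  e = refl
  norm1≡sum {suc n} e = cong (toℕ (e fzero) ℕ.+_) (norm1≡sum (e ∘ fsuc))

module AffineSubstitution (p : ℕ) .{{_ : NonZero p}} where
  open Field p using (Fp; Pt; sumₚ; affine)
  open ResidueRing p
  open import Algebra.Solver.Ring.NaturalCoefficients.Default commutativeSemiring using (solve; _:+_; _:*_; _:=_; con)
  open ≡-Reasoning

  unit : ∀ {n} → Fin n → Fin n → Fp
  unit fzero    fzero    = 1#
  unit fzero    (fsuc _) = 0#
  unit (fsuc _) fzero    = 0#
  unit (fsuc k) (fsuc l) = unit k l

  sumₚ-unit : ∀ {n} k (x : Pt n) → sumₚ (λ l → unit k l * x l) ≡ x k
  sumₚ-unit fzero    x =
    trans (cong₂ _+_ (*-identityˡ (x fzero)) (sumₚ-zero (x ∘ fsuc))) (+-identityʳ (x fzero))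
    where
      sumₚ-zero : ∀ {m} (y : Pt m) → sumₚ (λ l → 0# * y l) ≡ 0#
      sumₚ-zero {zero}  y = refl
      sumₚ-zero {suc m} y = trans (cong₂ _+_ (zeroˡ (y fzero)) (sumₚ-zero (y ∘ fsuc))) (+-identityʳ 0#)
  sumₚ-unit (fsuc k) x =
    trans (cong₂ _+_ (zeroˡ (x fzero)) (sumₚ-unit k (x ∘ fsuc))) (+-identityˡ (x (fsuc k)))

  sumₚ-linear : ∀ {n} c α (f g x : Pt n) →
                sumₚ (λ l → (c * f l + α * g l) * x l) ≡
                c * sumₚ (λ l → f l * x l) + α * sumₚ (λ l → g l * x l)
  sumₚ-linear {zero}  c α f g x = solve 2 (λ c α → con 0 := c :* con 0 :+ α :* con 0) refl c α
  sumₚ-linear {suc n} c α f g x =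
    trans (cong ((c * f fzero + α * g fzero) * x fzero +_) (sumₚ-linear c α (f ∘ fsuc) (g ∘ fsuc) (x ∘ fsuc)))
          (solve 7 (λ c α f g x F G → (c :* f :+ α :* g) :* x :+ (c :* F :+ α :* G)
                                    := c :* (f :* x :+ F) :+ α :* (g :* x :+ G))
                 refl c α (f fzero) (g fzero) (x fzero) (sumₚ (λ l → f (fsuc l) * x (fsuc l)))
                 (sumₚ (λ l → g (fsuc l) * x (fsuc l))))

  substitutionMatrix : ∀ {n} (i j : Fin n) (c α : Fp) → Fin n → Fin n → Fp
  substitutionMatrix i j c α = updateAt unit i (λ _ l → c * unit i l + α * unit j l)

  substitutionShift : ∀ {n} (i : Fin n) (β : Fp) → Pt n
  substitutionShift i β = updateAt (λ _ → 0#) i (λ _ → β)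

  affine-substitution : ∀ {n} (i j : Fin n) c α β x →
                        affine (substitutionMatrix i j c α) (substitutionShift i β) x
                        ≗ updateAt x i (λ xᵢ → c * xᵢ + (α * x j + β))
  affine-substitution i j c α β x k with k ≟ i
  ... | yes refl = begin
    sumₚ (λ l → substitutionMatrix i j c α i l * x l) + substitutionShift i β i
      ≡⟨ cong₂ (λ r z → sumₚ (λ l → r l * x l) + z)
               (updateAt-updates i unit) (updateAt-updates i (λ _ → 0#)) ⟩
    sumₚ (λ l → (c * unit i l + α * unit j l) * x l) + β
      ≡⟨ cong (_+ β) (sumₚ-linear c α (unit i) (unit j) x) ⟩
    c * sumₚ (λ l → unit i l * x l) + α * sumₚ (λ l → unit j l * x l) + β
      ≡⟨ cong₂ (λ y z → c * y + α * z + β) (sumₚ-unit i x) (sumₚ-unit j x) ⟩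
    c * x i + α * x j + β
      ≡⟨ +-assoc (c * x i) (α * x j) β ⟩
    c * x i + (α * x j + β)
      ≡⟨ updateAt-updates i x ⟨
    updateAt x i (λ xᵢ → c * xᵢ + (α * x j + β)) i ∎
  ... | no k≢i = begin
    sumₚ (λ l → substitutionMatrix i j c α k l * x l) + substitutionShift i β k
      ≡⟨ cong₂ (λ r z → sumₚ (λ l → r l * x l) + z)
               (updateAt-minimal k i unit k≢i) (updateAt-minimal k i (λ _ → 0#) k≢i) ⟩
    sumₚ (λ l → unit k l * x l) + 0#
      ≡⟨ +-identityʳ _ ⟩
    sumₚ (λ l → unit k l * x l)
      ≡⟨ sumₚ-unit k x ⟩
    x k
      ≡⟨ updateAt-minimal k i x k≢i ⟨
    updateAt x i (λ xᵢ → c * xᵢ + (α * x j + β)) k ∎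

module LinearFamily (p : ℕ) .{{_ : NonZero p}} (p-prime : Prime p) {n : ℕ} (𝓕 : Field.Family p n)
                    (𝓕-ext : Field.Extensional p 𝓕) (𝓕-lin : Field.IsLinear p 𝓕) where
  open Field p using (Fp; Fun)
  open ResidueRing p
  open Polynomials commutativeSemiring
  open import Algebra.Properties.Ring ring using (-1*x≈-x)
  open import Algebra.Properties.AbelianGroup +-abelianGroup using (xyx⁻¹≈y)
  open import Algebra.Properties.Semiring.Mult semiring using (×-comm-*)
  open import Algebra.Solver.Ring.NaturalCoefficients.Default commutativeSemiring using (solve; _:+_; _:*_; _:=_)
  open ≡-Reasoning

  ∈-resp : ∀ {f g : Fun n} → (∀ x → f x ≡ g x) → 𝓕 f → 𝓕 g
  ∈-resp = 𝓕-ext _ _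

  ∈-scale : ∀ α {f : Fun n} → 𝓕 f → 𝓕 (λ x → α * f x)
  ∈-scale α {f} f∈ = ∈-resp (λ x → trans (cong (α * f x +_) (zeroˡ 0#)) (+-identityʳ (α * f x)))
                            (proj₂ 𝓕-lin f (λ _ → 0#) α 0# f∈ (proj₁ 𝓕-lin))

  ∈-difference : ∀ {f g h : Fun n} → 𝓕 f → 𝓕 g → (∀ x → f x ≡ g x + h x) → 𝓕 h
  ∈-difference {f} {g} {h} f∈ g∈ f≡g+h = ∈-resp f-g≡h (proj₂ 𝓕-lin f g 1# (- 1#) f∈ g∈)
    where
      f-g≡h : ∀ x → 1# * f x + - 1# * g x ≡ h x
      f-g≡h x = begin
        1# * f x + - 1# * g x    ≡⟨ cong₂ _+_ (*-identityˡ (f x)) (-1*x≈-x (g x)) ⟩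
        f x - g x                ≡⟨ cong (_- g x) (f≡g+h x) ⟩
        g x + h x - g x          ≡⟨ xyx⁻¹≈y (g x) (h x) ⟩
        h x                      ∎

  ∈-cancel : ∀ {k} {f : Fun n} → 0 < k → k < p → 𝓕 (λ x → k × f x) → 𝓕 f
  ∈-cancel {k} {f} 0<k k<p kf∈ with []-invertible p-prime 0<k k<p
  ... | b , b[k]≡1 = ∈-resp b[k]f≡f (∈-scale b kf∈)
    where
      b[k]f≡f : ∀ x → b * (k × f x) ≡ f x
      b[k]f≡f x = begin
        b * (k × f x)       ≡⟨ cong (b *_) (×-[] k (f x)) ⟩
        b * ([ k ] * f x)   ≡⟨ *-assoc b [ k ] (f x) ⟨
        b * [ k ] * f x     ≡⟨ cong (_* f x) b[k]≡1 ⟩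
        1# * f x            ≡⟨ *-identityˡ (f x) ⟩
        f x                 ∎

  leading∈ : ∀ d {A : Fun n} {P : Fp → Fun n} → d < p → (∀ c → 𝓕 (P c)) →
             (∀ x → Polynomial d (A x) (λ c → P c x)) → 𝓕 A
  leading∈ zero    _ P∈ P-poly = ∈-resp (λ x → P-poly x 0#) (P∈ 0#)
  leading∈ (suc d) {A} {P} d<p P∈ P-poly =
    ∈-cancel (s≤s z≤n) d<p (leading∈ d (ℕ.<-trans (ℕ.n<1+n d) d<p) D∈ (λ x → proj₁ (proj₂ (Δ x))))
    where
      Δ = λ x → Polynomial-difference (P-poly x)
      D : Fp → Fun n
      D c x = proj₁ (Δ x) c
      D∈ : ∀ c → 𝓕 (D c)
      D∈ c = ∈-difference (P∈ (c + 1#)) (P∈ c) (λ x → proj₂ (proj₂ (Δ x)) c)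

  binomial∈ : ∀ a {t w G : Fun n} → suc a < p →
              (∀ c → 𝓕 (λ x → (c * t x + w x) ^ suc a * G x)) → 𝓕 (λ x → t x ^ suc a * G x) →
              𝓕 (λ x → t x ^ a * w x * G x)
  binomial∈ a {t} {w} {G} a<p substituted∈ tG∈ =
    ∈-cancel (s≤s z≤n) a<p (∈-resp leading (leading∈ a (ℕ.<-trans (ℕ.n<1+n a) a<p) P∈ P-poly))
    where
      expansion = λ x → Polynomial-binomial (t x) (w x) a
      Q : Fp → Fun n
      Q c x = proj₁ (expansion x) c
      P-poly : ∀ x → Polynomial a (G x * (suc a × (t x ^ a * w x))) (λ c → G x * Q c x)
      P-poly x = Polynomial-scale (G x) (proj₁ (proj₂ (expansion x)))
      P∈ : ∀ c → 𝓕 (λ x → G x * Q c x)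
      P∈ c = ∈-difference (substituted∈ c) (∈-scale (c ^ suc a) tG∈) λ x → begin
        (c * t x + w x) ^ suc a * G x
          ≡⟨ cong (_* G x) (proj₂ (proj₂ (expansion x)) c) ⟩
        (c ^ suc a * t x ^ suc a + Q c x) * G x
          ≡⟨ solve 4 (λ C T q g → (C :* T :+ q) :* g := C :* (T :* g) :+ g :* q)
                   refl (c ^ suc a) (t x ^ suc a) (Q c x) (G x) ⟩
        c ^ suc a * (t x ^ suc a * G x) + G x * Q c x ∎
      leading : ∀ x → G x * (suc a × (t x ^ a * w x)) ≡ suc a × (t x ^ a * w x * G x)
      leading x = trans (×-comm-* (suc a) (G x) (t x ^ a * w x))
                        (cong (suc a ×_) (*-comm (G x) (t x ^ a * w x)))

module AffineInvariantFamily (p : ℕ) .{{_ : NonZero p}} (p-prime : Prime p) {n : ℕ} (𝓕 : Field.Family p n)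
                             (𝓕-ext : Field.Extensional p 𝓕) (𝓕-lin : Field.IsLinear p 𝓕)
                             (𝓕-aff : Field.AffineInvariant p 𝓕) where
  open Field p using (affine)
  open ResidueRing p
  open LinearFamily p p-prime 𝓕 𝓕-ext 𝓕-lin
  open Monomials p
  open AffineSubstitution p
  open import Algebra.Solver.Ring.NaturalCoefficients.Default commutativeSemiring using (solve; _:+_; _:*_; _:=_; con)
  open ≡-Reasoning

  substituted∈ : ∀ {u} → 𝓕 (monomial u) → ∀ i j c α β →
                 𝓕 (λ x → (c * x i + (α * x j + β)) ^ u i * monomial (updateAt u i (λ _ → 0)) x)
  substituted∈ {u} u∈ i j c α β =
    ∈-resp expand (𝓕-aff (monomial u) (substitutionMatrix i j c α) (substitutionShift i β) u∈)
    where
      expand : ∀ x → monomial u (affine (substitutionMatrix i j c α) (substitutionShift i β) x)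
                     ≡ (c * x i + (α * x j + β)) ^ u i * monomial (updateAt u i (λ _ → 0)) x
      expand x = begin
        monomial u (affine (substitutionMatrix i j c α) (substitutionShift i β) x)
          ≡⟨ monomial-cong {u = u} (λ _ → refl) (affine-substitution i j c α β x) ⟩
        monomial u (updateAt x i g)
          ≡⟨ monomial-split u i (updateAt x i g) ⟩
        updateAt x i g i ^ u i * monomial (updateAt u i (λ _ → 0)) (updateAt x i g)
          ≡⟨ cong₂ (λ y z → y ^ u i * z) (updateAt-updates i x) (monomial-ignores u i g x) ⟩
        g (x i) ^ u i * monomial (updateAt u i (λ _ → 0)) x ∎
        where g = λ xᵢ → c * xᵢ + (α * x j + β)

  lowered∈ : ∀ {u} i → 0 < u i → u i < p → 𝓕 (monomial u) → ∀ j α β →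
             𝓕 (λ x → x i ^ pred (u i) * (α * x j + β) * monomial (updateAt u i (λ _ → 0)) x)
  lowered∈ {u} i 0<ui ui<p u∈ j α β =
    binomial∈ (pred (u i)) {t = λ x → x i} {w = λ x → α * x j + β} {G = G} (subst (_< p) ui≡ ui<p)
      (λ c → ∈-resp (λ x → cong (λ k → (c * x i + (α * x j + β)) ^ k * G x) ui≡)
                    (substituted∈ {u} u∈ i j c α β))
      (∈-resp (λ x → trans (monomial-split u i x) (cong (λ k → x i ^ k * G x) ui≡)) u∈)
    where
      G = monomial (updateAt u i (λ _ → 0))
      ui≡ : u i ≡ suc (pred (u i))
      ui≡ = sym (ℕ.suc-pred (u i) {{ℕ.>-nonZero 0<ui}})

  decrease∈ : ∀ {u} i → 0 < u i → u i < p → 𝓕 (monomial u) → 𝓕 (monomial (updateAt u i pred))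
  decrease∈ {u} i 0<ui ui<p u∈ = ∈-resp (λ x → begin
    x i ^ pred (u i) * (0# * x i + 1#) * G x
      ≡⟨ solve 3 (λ X y g → X :* (con 0 :* y :+ con 1) :* g := X :* g) refl (x i ^ pred (u i)) (x i) (G x) ⟩
    x i ^ pred (u i) * G x
      ≡⟨ monomial-updateAt u i pred x ⟨
    monomial (updateAt u i pred) x ∎) (lowered∈ i 0<ui ui<p u∈ i 0# 1#)
    where G = monomial (updateAt u i (λ _ → 0))

  transfer∈ : ∀ {u} i j → 0 < u i → u i < p → 𝓕 (monomial u) →
              𝓕 (monomial (updateAt (updateAt u i pred) j suc))
  transfer∈ {u} i j 0<ui ui<p u∈ = ∈-resp (λ x → begin
    x i ^ pred (u i) * (1# * x j + 0#) * G x
      ≡⟨ solve 3 (λ X y g → X :* (con 1 :* y :+ con 0) :* g := y :* (X :* g)) refl (x i ^ pred (u i)) (x j) (G x) ⟩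
    x j * (x i ^ pred (u i) * G x)
      ≡⟨ cong (x j *_) (monomial-updateAt u i pred x) ⟨
    x j * monomial (updateAt u i pred) x
      ≡⟨ monomial-updateAt-suc (updateAt u i pred) j x ⟨
    monomial (updateAt (updateAt u i pred) j suc) x ∎) (lowered∈ i 0<ui ui<p u∈ j 1# 0#)
    where G = monomial (updateAt u i (λ _ → 0))

lemma3p1 : (p : ℕ) .{{_ : NonZero p}} → Prime p → (n : ℕ) → 1 ≤ n →
    (𝓕 : Field.Family p n) → Field.Extensional p 𝓕 → Field.IsLinear p 𝓕 → Field.AffineInvariant p 𝓕 →
    (e : Field.Exp p n) → 𝓕 (Field.mono p e) →
    (e' : Field.Exp p n) → Field.norm1 p e' ≤ Field.norm1 p e → 𝓕 (Field.mono p e')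
lemma3p1 p p-prime n _ 𝓕 𝓕-ext 𝓕-lin 𝓕-aff e e∈ e′ |e′|≤|e| =
  𝓕-ext _ _ (sym ∘ mono≡monomial e′)
    (reachable (𝓕-ext _ _ (mono≡monomial e) e∈) (toℕ<n ∘ e) (toℕ<n ∘ e′)
               (subst₂ _≤_ (norm1≡sum e′) (norm1≡sum e) |e′|≤|e|))
  where
    open Monomials p
    open AffineInvariantFamily p p-prime 𝓕 𝓕-ext 𝓕-lin 𝓕-aff
    open Reachability p (𝓕 ∘ monomial) (λ u≗w → 𝓕-ext _ _ (λ _ → monomial-cong u≗w (λ _ → refl)))
                      decrease∈ transfer∈
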